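{- Let $g$ be a reality for a schema context on the relation scheme $U$. Then $g$ is a strong reality if and only if for every $A\in U$ there is a co-prime/prime pair $(c,p)$ of $L_A$ such that $c$ is the least element of $\{x_A\in L_A: g_{|A}(x_A)=1\}$ and $p$ is the greatest element of $\{x_A\in L_A: g_{|A}(x_A)=0\}$.
   Context: Each attribute $A$ of the finite relation scheme $U=\{A_1,\dots,A_n\}$ has a finite lattice $L_A$ with bottom $0_A$ and top $1_A$; $L_U=\prod_{A\in U}L_A$ with componentwise order. An attribute interpretation of $A$ is an increasing map $h_A:L_A\to\{0,1\}$ with $h_A(0_A)=0$, $h_A(1_A)=1$; a schema interpretation is $g(\langle x_1,\dots,x_n\rangle)=\langle h_{A_1}(x_1),\dots,h_{A_n}(x_n)\rangle\in\{0,1\}^n$ (componentwise order), and $g_{|A}(x)=h_A(x[A])$ (also viewed as a function of $x[A]\in L_A$). A reality is a schema interpretation that is a $\wedge$-homomorphism; a strong reality is a schema interpretation that is a lattice homomorphism (preserves binary meets and joins). In a lattice $L$, $p$ is prime if $y\wedge z\le p$ implies $y\le p$ or $z\le p$; $c$ is co-prime if $c\le y\vee z$ implies $c\le y$ or $c\le z$. A co-prime/prime pair $(c,p)$ consists of a co-prime $c$ and a prime $p$ such that $c$ is the least element of $\{x\in L: x\not\le p\}$ (equivalently $p$ is the greatest element of $\{x\in L: x\not\ge c\}$). -}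

module Defs where

open import Level using (Level; _⊔_)
open import Data.Nat using (ℕ)
open import Data.Fin using (Fin)
open import Data.Bool using (Bool; true; false) renaming (_∧_ to _∧ᵇ_; _∨_ to _∨ᵇ_; _≤_ to _≤ᵇ_)
open import Data.Product using (Σ; _×_; ∃; ∃-syntax)
open import Data.Sum using (_⊎_)
open import Relation.Nullary using (¬_)
open import Relation.Binary.PropositionalEquality using (_≡_)
open import Relation.Binary.Lattice.Bundles using (BoundedLattice)

private variable c ℓ₁ ℓ₂ : Level

IsFinite : BoundedLattice c ℓ₁ ℓ₂ → Set (c ⊔ ℓ₁)
IsFinite L = ∃[ k ] Σ (Fin k → Carrier) λ f → ∀ x → ∃[ i ] (f i ≈ x)
  where open BoundedLattice L

record FiniteLattice c ℓ₁ ℓ₂ : Set (Level.suc (c ⊔ ℓ₁ ⊔ ℓ₂)) where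
  field
    boundedLattice : BoundedLattice c ℓ₁ ℓ₂
    isFinite : IsFinite boundedLattice
  open BoundedLattice boundedLattice public hiding (lattice)

module _ (L : BoundedLattice c ℓ₁ ℓ₂) where
  open BoundedLattice L

  IsPrime : Carrier → Set (c ⊔ ℓ₂)
  IsPrime p = ∀ y z → (y ∧ z) ≤ p → y ≤ p ⊎ z ≤ p

  IsCoPrime : Carrier → Set (c ⊔ ℓ₂)
  IsCoPrime a = ∀ y z → a ≤ (y ∨ z) → a ≤ y ⊎ a ≤ z

  IsLeast : ∀ {ℓ} → (Carrier → Set ℓ) → Carrier → Set (c ⊔ ℓ₂ ⊔ ℓ)
  IsLeast S a = S a × (∀ x → S x → a ≤ x)

  IsGreatest : ∀ {ℓ} → (Carrier → Set ℓ) → Carrier → Set (c ⊔ ℓ₂ ⊔ ℓ)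
  IsGreatest S a = S a × (∀ x → S x → x ≤ a)

  IsCoPrimePrimePair : Carrier → Carrier → Set (c ⊔ ℓ₂)
  IsCoPrimePrimePair a p =
    IsCoPrime a × IsPrime p × IsLeast (λ x → ¬ (x ≤ p)) a

  IsAttrInterp : (Carrier → Bool) → Set (c ⊔ ℓ₂)
  IsAttrInterp h = (∀ x y → x ≤ y → h x ≤ᵇ h y) × (h ⊥ ≡ false) × (h ⊤ ≡ true)

-- A schema context on U = Fin n: a finite lattice L A for each attribute A.
module Schema {n : ℕ} (L : Fin n → FiniteLattice c ℓ₁ ℓ₂) where
  open FiniteLattice

  LU : Set c
  LU = (A : Fin n) → Carrier (L A)

  _∧U_ : LU → LU → LU
  (x ∧U y) A = _∧_ (L A) (x A) (y A)

  _∨U_ : LU → LU → LU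
  (x ∨U y) A = _∨_ (L A) (x A) (y A)

  Bits : Set
  Bits = Fin n → Bool

  _∧B_ : Bits → Bits → Bits
  (u ∧B v) A = u A ∧ᵇ v A

  _∨B_ : Bits → Bits → Bits
  (u ∨B v) A = u A ∨ᵇ v A

  _≡B_ : Bits → Bits → Set
  u ≡B v = ∀ A → u A ≡ v A

  AttrInterps : Set (c ⊔ ℓ₂)
  AttrInterps = (A : Fin n) → Σ (Carrier (L A) → Bool) (IsAttrInterp (boundedLattice (L A)))

  -- the schema interpretation g determined by the h_A
  schemaInterp : AttrInterps → LU → Bits
  schemaInterp h x A = Data.Product.proj₁ (h A) (x A)

  restrict : AttrInterps → (A : Fin n) → Carrier (L A) → Bool
  restrict h A = Data.Product.proj₁ (h A)

  IsReality : AttrInterps → Set c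
  IsReality h = ∀ x y → schemaInterp h (x ∧U y) ≡B (schemaInterp h x ∧B schemaInterp h y)

  IsStrongReality : AttrInterps → Set c
  IsStrongReality h =
    (∀ x y → schemaInterp h (x ∧U y) ≡B (schemaInterp h x ∧B schemaInterp h y)) ×
    (∀ x y → schemaInterp h (x ∨U y) ≡B (schemaInterp h x ∨B schemaInterp h y))

-- Both operations act componentwise, so g is a strong
-- reality exactly when every attribute interpretation h_A : L_A → Bool
-- preserves binary joins.  The theorem therefore reduces to a statement about
-- one monotone map h : L → Bool on a finite bounded lattice L:
--
--  * if h⁻¹(0) has a greatest element p, then h preserves joins
--    (h (x ∨ y) = 0 forces x, y ≤ p, hence x ∨ y ≤ p);
--  * if h preserves meets and joins, then h⁻¹(1) is closed under ∧ and
--    contains ⊤, so in a finite lattice it has a least element a (the meet of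
--    all its members); dually h⁻¹(0) has a greatest element p;
--  * for such a and p, the pair (a , p) is a co-prime/prime pair.
module Submission where

open import Defs
open import Level using (Level; _⊔_)
open import Data.Nat using (ℕ; zero; suc)
open import Data.Fin using (Fin; zero; suc; _≟_)
open import Data.Bool using (Bool; true; false; f≤t; b≤b)
  renaming (_∧_ to _∧ᵇ_; _∨_ to _∨ᵇ_; _≤_ to _≤ᵇ_)
import Data.Bool as Bool
open import Data.Bool.Properties using (¬-not) renaming (≤-antisym to ≤ᵇ-antisym)
open import Data.Product using (Σ; _×_; ∃; ∃-syntax; _,_; proj₁; proj₂)
open import Data.Sum using (_⊎_; inj₁; inj₂)
import Data.Sum as Sum
open import Data.Empty using (⊥-elim)
open import Function.Bundles using (_⇔_; mk⇔)
open import Relation.Nullary using (¬_; yes; no)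
open import Relation.Unary using (Pred; Decidable)
open import Relation.Binary.Definitions using (_Respects_)
open import Relation.Binary.PropositionalEquality
  using (_≡_; refl; sym; trans; subst; subst₂)
open import Relation.Binary.Lattice.Bundles using (MeetSemilattice; BoundedLattice)
import Relation.Binary.Lattice.Properties.JoinSemilattice as JoinProperties

≤ᵇ-true : ∀ {x y} → x ≤ᵇ y → x ≡ true → y ≡ true
≤ᵇ-true b≤b x≡t = x≡t
≤ᵇ-true f≤t _   = refl

≤ᵇ-false : ∀ {x y} → x ≤ᵇ y → y ≡ false → x ≡ false
≤ᵇ-false b≤b y≡f = y≡f

∨ᵇ-true : ∀ x y → x ∨ᵇ y ≡ true → x ≡ true ⊎ y ≡ true
∨ᵇ-true true  _ _   = inj₁ refl
∨ᵇ-true false _ y≡t = inj₂ y≡t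

∧ᵇ-false : ∀ x y → x ∧ᵇ y ≡ false → x ≡ false ⊎ y ≡ false
∧ᵇ-false false _ _   = inj₁ refl
∧ᵇ-false true  _ y≡f = inj₂ y≡f

module FiniteMeets {c ℓ₁ ℓ₂} (M : MeetSemilattice c ℓ₁ ℓ₂) where
  open MeetSemilattice M hiding (refl) renaming (trans to ≤-trans)

  Enumerable : Set (c ⊔ ℓ₁)
  Enumerable = ∃[ k ] Σ (Fin k → Carrier) λ f → ∀ x → ∃[ i ] (f i ≈ x)

  ∧-Closed : ∀ {ℓ} → Pred Carrier ℓ → Set (c ⊔ ℓ)
  ∧-Closed P = ∀ x y → P x → P y → P (x ∧ y)

  -- The meet of a finite family, seeded with x₀ so that empty families are
  -- allowed.
  meetFrom : Carrier → ∀ {k} → (Fin k → Carrier) → Carrier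
  meetFrom x₀ {zero}  g = x₀
  meetFrom x₀ {suc k} g = g zero ∧ meetFrom x₀ (λ i → g (suc i))

  meetFrom-lower : ∀ x₀ {k} (g : Fin k → Carrier) i → meetFrom x₀ g ≤ g i
  meetFrom-lower x₀ g zero    = x∧y≤x _ _
  meetFrom-lower x₀ g (suc i) = ≤-trans (x∧y≤y _ _) (meetFrom-lower x₀ (λ j → g (suc j)) i)

  meetFrom-closed : ∀ {ℓ} {P : Pred Carrier ℓ} → ∧-Closed P →
                    ∀ {x₀} → P x₀ → ∀ {k} (g : Fin k → Carrier) → (∀ i → P (g i)) →
                    P (meetFrom x₀ g)
  meetFrom-closed closed P₀ {zero}  g Pg = P₀
  meetFrom-closed closed P₀ {suc k} g Pg =
    closed _ _ (Pg zero) (meetFrom-closed closed P₀ (λ i → g (suc i)) (λ i → Pg (suc i)))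

  -- In a finite meet semilattice, a decidable, ≈-invariant, ∧-closed and
  -- inhabited predicate has a least element: the meet of all its members.
  least-of-∧-closed : ∀ {ℓ} {P : Pred Carrier ℓ} → Decidable P → P Respects _≈_ →
                      ∧-Closed P → ∀ {x₀} → P x₀ → Enumerable →
                      ∃[ a ] (P a × (∀ x → P x → a ≤ x))
  least-of-∧-closed {P = P} P? resp closed {x₀} P₀ (k , f , covers) =
    meetFrom x₀ members , meetFrom-closed closed P₀ members (λ i → member-P (f i)) , lower
    where
    member : Carrier → Carrier
    member x with P? x
    ... | yes _ = x
    ... | no  _ = x₀

    member-P : ∀ x → P (member x)
    member-P x with P? x
    ... | yes Px = Px
    ... | no  _  = P₀

    member-≡ : ∀ x → P x → member x ≡ x
    member-≡ x Px with P? x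
    ... | yes _   = refl
    ... | no ¬Px  = ⊥-elim (¬Px Px)

    members : Fin k → Carrier
    members i = member (f i)

    lower : ∀ x → P x → meetFrom x₀ members ≤ x
    lower x Px with covers x
    ... | i , fi≈x =
      ≤-trans (subst (meetFrom x₀ members ≤_) (member-≡ (f i) (resp (Eq.sym fi≈x) Px))
                     (meetFrom-lower x₀ members i))
              (reflexive fi≈x)

module MonotoneTest {c ℓ₁ ℓ₂} (L : BoundedLattice c ℓ₁ ℓ₂) (h : BoundedLattice.Carrier L → Bool)
                    (mono : ∀ x y → BoundedLattice._≤_ L x y → h x ≤ᵇ h y) where
  open BoundedLattice L hiding (refl) renaming (trans to ≤-trans)

  PreservesMeets : Set c
  PreservesMeets = ∀ x y → h (x ∧ y) ≡ h x ∧ᵇ h y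

  PreservesJoins : Set c
  PreservesJoins = ∀ x y → h (x ∨ y) ≡ h x ∨ᵇ h y

  true-upward : ∀ {x y} → x ≤ y → h x ≡ true → h y ≡ true
  true-upward {x} {y} x≤y = ≤ᵇ-true (mono x y x≤y)

  false-downward : ∀ {x y} → x ≤ y → h y ≡ false → h x ≡ false
  false-downward {x} {y} x≤y = ≤ᵇ-false (mono x y x≤y)

  true-not-below-false : ∀ {x y} → h x ≡ true → h y ≡ false → ¬ (x ≤ y)
  true-not-below-false hx≡t hy≡f x≤y with () ← trans (sym (true-upward x≤y hx≡t)) hy≡f

  -- If h⁻¹(false) has a greatest element p, h preserves joins: when both
  -- arguments are false they lie below p, and so does their join.
  greatest-false⇒joins : ∀ {p} → IsGreatest L (λ x → h x ≡ false) p → PreservesJoins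
  greatest-false⇒joins {p} (hp≡f , below-p) x y with h x in hx | h y in hy
  ... | true  | _     = true-upward (x≤x∨y x y) hx
  ... | false | true  = true-upward (y≤x∨y x y) hy
  ... | false | false = false-downward (∨-least (below-p x hx) (below-p y hy)) hp≡f

  extremes⇒pair : PreservesMeets → PreservesJoins →
                  ∀ {a p} → IsLeast L (λ x → h x ≡ true) a → IsGreatest L (λ x → h x ≡ false) p →
                  IsCoPrimePrimePair L a p
  extremes⇒pair meets joins {a} {p} (ha≡t , above-a) (hp≡f , below-p) =
    co-prime , prime , true-not-below-false ha≡t hp≡f , least-not-below-p
    where
    co-prime : IsCoPrime L a
    co-prime y z a≤y∨z = Sum.map (above-a y) (above-a z)
      (∨ᵇ-true (h y) (h z) (trans (sym (joins y z)) (true-upward a≤y∨z ha≡t)))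

    prime : IsPrime L p
    prime y z y∧z≤p = Sum.map (below-p y) (below-p z)
      (∧ᵇ-false (h y) (h z) (trans (sym (meets y z)) (false-downward y∧z≤p hp≡f)))

    least-not-below-p : ∀ x → ¬ (x ≤ p) → a ≤ x
    least-not-below-p x x≰p = above-a x (¬-not (λ hx≡f → x≰p (below-p x hx≡f)))

  -- h is constant on ≈-classes, being monotone in both directions.
  respects : ∀ b → (λ x → h x ≡ b) Respects _≈_
  respects b {x} {y} x≈y hx≡b =
    trans (sym (≤ᵇ-antisym (mono x y (reflexive x≈y)) (mono y x (reflexive (Eq.sym x≈y))))) hx≡b

  least-true : IsFinite L → h ⊤ ≡ true → PreservesMeets → ∃[ a ] IsLeast L (λ x → h x ≡ true) a
  least-true finite h⊤≡t meets =
    FiniteMeets.least-of-∧-closed meetSemilattice (λ x → h x Bool.≟ true) (respects true)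
      (λ x y hx≡t hy≡t → trans (meets x y) (both-true hx≡t hy≡t)) h⊤≡t finite
    where
    both-true : ∀ {u v} → u ≡ true → v ≡ true → u ∧ᵇ v ≡ true
    both-true refl refl = refl

  -- Dually, if h preserves joins and h ⊥ = false, then h⁻¹(false) has a
  -- greatest element (the least-element lemma in the dual order).
  greatest-false : IsFinite L → h ⊥ ≡ false → PreservesJoins → ∃[ p ] IsGreatest L (λ x → h x ≡ false) p
  greatest-false finite h⊥≡f joins =
    FiniteMeets.least-of-∧-closed (JoinProperties.dualMeetSemilattice joinSemilattice)
      (λ x → h x Bool.≟ false) (respects false)
      (λ x y hx≡f hy≡f → trans (joins x y) (both-false hx≡f hy≡f)) h⊥≡f finite
    where
    both-false : ∀ {u v} → u ≡ false → v ≡ false → u ∨ᵇ v ≡ false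
    both-false refl refl = refl

  homomorphism⇒pair : IsFinite L → h ⊤ ≡ true → h ⊥ ≡ false → PreservesMeets → PreservesJoins →
                      ∃[ a ] ∃[ p ] (IsCoPrimePrimePair L a p
                                     × IsLeast L (λ x → h x ≡ true) a
                                     × IsGreatest L (λ x → h x ≡ false) p)
  homomorphism⇒pair finite h⊤≡t h⊥≡f meets joins =
    let (a , least) = least-true finite h⊤≡t meets
        (p , greatest) = greatest-false finite h⊥≡f joins
    in a , p , extremes⇒pair meets joins least greatest , least , greatest

module Components {c ℓ₁ ℓ₂} {n : ℕ} (L : Fin n → FiniteLattice c ℓ₁ ℓ₂) where
  open Schema L
  open FiniteLattice using (Carrier; ⊤)

  point : (A : Fin n) → Carrier (L A) → LU
  point A a B with A ≟ B
  ... | yes refl = a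
  ... | no  _    = ⊤ (L B)

  point-at : ∀ A a → point A a A ≡ a
  point-at A a with A ≟ A
  ... | yes refl = refl
  ... | no  A≢A  = ⊥-elim (A≢A refl)

  -- If g preserves a componentwise operation, so does every g_{|A}: evaluate
  -- g on the tuples  point A a  and  point A b.
  component-hom : (h : AttrInterps) (op : ∀ A → Carrier (L A) → Carrier (L A) → Carrier (L A))
                  (bop : Bool → Bool → Bool) →
                  (∀ (x y : LU) A → restrict h A (op A (x A) (y A)) ≡ bop (restrict h A (x A)) (restrict h A (y A))) →
                  ∀ A a b → restrict h A (op A a b) ≡ bop (restrict h A a) (restrict h A b)
  component-hom h op bop hom A a b =
    subst₂ (λ u v → restrict h A (op A u v) ≡ bop (restrict h A u) (restrict h A v))
           (point-at A a) (point-at A b) (hom (point A a) (point A b) A)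

proposition4 : ∀ {c ℓ₁ ℓ₂ : Level} {n : ℕ} (L : Fin n → FiniteLattice c ℓ₁ ℓ₂)
    → let open Schema L in
      (h : AttrInterps) → IsReality h →
      IsStrongReality h ⇔
        (∀ (A : Fin n) → ∃[ a ] ∃[ p ]
          (IsCoPrimePrimePair (FiniteLattice.boundedLattice (L A)) a p
           × IsLeast (FiniteLattice.boundedLattice (L A)) (λ x → restrict h A x ≡ true) a
           × IsGreatest (FiniteLattice.boundedLattice (L A)) (λ x → restrict h A x ≡ false) p))
proposition4 L h reality = mk⇔
  (λ (meets , joins) A →
    let (_ , _ , h⊥≡false , h⊤≡true) = h A in
    Attribute.homomorphism⇒pair A (FiniteLattice.isFinite (L A)) h⊤≡true h⊥≡false
      (component-hom h (λ B → FiniteLattice._∧_ (L B)) _∧ᵇ_ meets A)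
      (component-hom h (λ B → FiniteLattice._∨_ (L B)) _∨ᵇ_ joins A))
  (λ pairs → reality , λ x y A →
    let (_ , _ , _ , _ , greatest-false) = pairs A in
    Attribute.greatest-false⇒joins A greatest-false (x A) (y A))
  where
  open Components L
  module Attribute A = MonotoneTest (FiniteLattice.boundedLattice (L A)) (proj₁ (h A)) (proj₁ (proj₂ (h A)))
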